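{- Let $n\ge 6$ be even. Then for every integer $k$ with $3\le k\le n$, the graph $A_n$ has a cycle of length $k$ if and only if $k$ is even.
   Context: For $n\ge 6$, $A_n$ is the graph on $n$ vertices consisting of a rim cycle $1,2,\dots,n-2,1$ on $n-2$ vertices, two further vertices $u$ and $w$ joined by an edge $uw$, where $u$ is adjacent exactly to the odd-labelled rim vertices $1,3,5,\dots$ and $w$ is adjacent exactly to the even-labelled rim vertices $2,4,6,\dots$ (among rim vertices). Equivalently, $A_n$ is obtained from the bicycle wheel $B_n$ (rim cycle on $n-2$ vertices, two adjacent hubs each joined to all rim vertices) by deleting alternate spokes from each hub so that each rim vertex is joined to exactly one hub, the hubs alternating around the rim. -}

module Defs where

open import Data.Nat using (ℕ; zero; suc; _∸_; _<_)
open import Data.Nat.Divisibility using (_∣_)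
open import Data.Fin using (Fin; toℕ)
open import Data.Product using (Σ; _×_)
open import Data.Sum using (_⊎_)
open import Relation.Nullary using (¬_)
open import Relation.Binary.PropositionalEquality using (_≡_)
open import Function.Definitions using (Injective)

-- Vertex encoding of A_n on Fin n, with m = n ∸ 2 rim vertices:
--   index a < m  is the rim vertex labelled a + 1  (so labels 1 .. n-2),
--   index m      is the hub u (adjacent to odd labels, i.e. even indices),
--   index m + 1  is the hub w (adjacent to even labels, i.e. odd indices).
data Edge (m : ℕ) : ℕ → ℕ → Set where
  rim    : ∀ {a} → suc a < m → Edge m a (suc a)
  wrap   : Edge m 0 (m ∸ 1)
  hub    : Edge m m (suc m)
  spokeU : ∀ {a} → a < m → 2 ∣ a → Edge m m a
  spokeW : ∀ {a} → a < m → ¬ (2 ∣ a) → Edge m (suc m) a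

Adj : (n : ℕ) → Fin n → Fin n → Set
Adj n x y = Edge (n ∸ 2) (toℕ x) (toℕ y) ⊎ Edge (n ∸ 2) (toℕ y) (toℕ x)

CycSucc : (k : ℕ) → Fin k → Fin k → Set
CycSucc k i j = (toℕ j ≡ suc (toℕ i)) ⊎ ((suc (toℕ i) ≡ k) × (toℕ j ≡ 0))

HasCycle : (n k : ℕ) → Set
HasCycle n k = Σ (Fin k → Fin n) λ f →
  Injective _≡_ _≡_ f × (∀ i j → CycSucc k i j → Adj n (f i) (f j))

{-# OPTIONS --safe #-}
-- Colour the vertices of A_n by ℤ/2: a rim vertex by the parity of its index, and
-- the hubs u and w by the opposite of the parity of their indices m and m + 1.  When m = n - 2
-- is even every edge joins vertices of different colours, so going once around a cycle flips
-- the colour as many times as the cycle is long, and that length must be even.  Conversely,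
-- for odd r < m, the hub w, the hub u and the rim path 0, 1, …, r form a cycle of length r + 3.
module Submission where

open import Defs
open import Data.Nat using (ℕ; _≤_)
open import Data.Nat.Divisibility using (_∣_)
open import Function.Bundles using (_⇔_)

open import Data.Nat.Base using (zero; suc; _<_; _+_; parity; z≤n; s≤s; s≤s⁻¹)
open import Data.Nat.Properties
  using (≤-refl; <-trans; m<n⇒m<1+n; n≮n; n≤1+n; n<1+n; 1+n≢n; <⇒≢; <-≤-trans; suc-injective)
  renaming (_<?_ to _ℕ<?_)
open import Data.Nat.Divisibility using (divides; _∣0; ∣-refl; ∣m∣n⇒∣m+n)
open import Data.Parity.Base using (Parity; 0ℙ; 1ℙ; _⁻¹) renaming (_+_ to _⊕_)
open import Data.Parity.Properties using (suc-homo-⁻¹; ⁻¹-selfInverse; *-homo-*; *-zeroʳ; +-assoc; +-cancelʳ-≡)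
open import Data.Fin.Base using (Fin; toℕ; fromℕ<) renaming (zero to fzero; suc to fsuc)
open import Data.Fin.Properties using (toℕ-fromℕ<; toℕ-injective; toℕ<n)
open import Data.Product using (_,_)
open import Data.Sum using (inj₁; inj₂; swap)
open import Function.Base using (_∘_)
open import Function.Bundles using (mk⇔)
open import Function.Definitions using (Injective)
open import Relation.Nullary using (¬_; yes; no; contradiction)
open import Relation.Binary.PropositionalEquality
  using (_≡_; refl; sym; trans; cong; subst; subst₂; module ≡-Reasoning)

2∣⇒parity≡0ℙ : ∀ {n} → 2 ∣ n → parity n ≡ 0ℙ
2∣⇒parity≡0ℙ (divides q refl) = trans (*-homo-* q 2) (*-zeroʳ (parity q))

parity≡0ℙ⇒2∣ : ∀ n → parity n ≡ 0ℙ → 2 ∣ n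
parity≡0ℙ⇒2∣ zero          _ = 2 ∣0
parity≡0ℙ⇒2∣ (suc zero)    ()
parity≡0ℙ⇒2∣ (suc (suc n)) p = ∣m∣n⇒∣m+n ∣-refl (parity≡0ℙ⇒2∣ n p)

¬2∣⇒parity≡1ℙ : ∀ {n} → ¬ 2 ∣ n → parity n ≡ 1ℙ
¬2∣⇒parity≡1ℙ {n} 2∤n with parity n in p
... | 0ℙ = contradiction (parity≡0ℙ⇒2∣ n p) 2∤n
... | 1ℙ = refl

parity≡1ℙ⇒¬2∣ : ∀ {n} → parity n ≡ 1ℙ → ¬ 2 ∣ n
parity≡1ℙ⇒¬2∣ p 2∣n with trans (sym p) (2∣⇒parity≡0ℙ 2∣n)
... | ()

parity-suc : ∀ n → parity (suc n) ≡ parity n ⁻¹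
parity-suc n = sym (⁻¹-selfInverse (suc-homo-⁻¹ n))

parity[1+n]≡0ℙ⇒parity[n]≡1ℙ : ∀ n → parity (suc n) ≡ 0ℙ → parity n ≡ 1ℙ
parity[1+n]≡0ℙ⇒parity[n]≡1ℙ n p = sym (⁻¹-selfInverse (trans (sym (parity-suc n)) p))

parity-suc-⊕ : ∀ t p → parity (suc t) ⊕ p ≡ (parity t ⊕ p) ⁻¹
parity-suc-⊕ t p = trans (cong (_⊕ p) (parity-suc t)) (+-assoc 1ℙ (parity t) p)

CyclicallyAlternating : ∀ {k} → (Fin k → Parity) → Set
CyclicallyAlternating {k} g = ∀ i j → CycSucc k i j → g j ≡ g i ⁻¹

cyclicallyAlternating⇒parity≡0ℙ : ∀ {k} (g : Fin k → Parity) →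
                                   CyclicallyAlternating g → parity k ≡ 0ℙ
cyclicallyAlternating⇒parity≡0ℙ {zero}   g alt = refl
cyclicallyAlternating⇒parity≡0ℙ {suc k′} g alt =
  sym (+-cancelʳ-≡ (g fzero) 0ℙ (parity (suc k′)) (begin
    g fzero                    ≡⟨ alt last fzero (inj₂ (cong suc (toℕ-fromℕ< k′<k) , refl)) ⟩
    g last ⁻¹                  ≡⟨ cong _⁻¹ (around k′ k′<k) ⟩
    (parity k′ ⊕ g fzero) ⁻¹   ≡⟨ parity-suc-⊕ k′ (g fzero) ⟨
    parity (suc k′) ⊕ g fzero  ∎))
  where
  open ≡-Reasoning
  k′<k : k′ < suc k′
  k′<k = n<1+n k′
  last : Fin (suc k′)
  last = fromℕ< k′<k
  around : ∀ t (t<k : t < suc k′) → g (fromℕ< t<k) ≡ parity t ⊕ g fzero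
  around zero    _     = refl
  around (suc t) 1+t<k = begin
    g (fromℕ< 1+t<k)           ≡⟨ alt (fromℕ< t<k) (fromℕ< 1+t<k) (inj₁ successor) ⟩
    g (fromℕ< t<k) ⁻¹          ≡⟨ cong _⁻¹ (around t t<k) ⟩
    (parity t ⊕ g fzero) ⁻¹    ≡⟨ parity-suc-⊕ t (g fzero) ⟨
    parity (suc t) ⊕ g fzero   ∎
    where
    t<k : t < suc k′
    t<k = <-trans (n<1+n t) 1+t<k
    successor : toℕ (fromℕ< 1+t<k) ≡ suc (toℕ (fromℕ< t<k))
    successor = trans (toℕ-fromℕ< 1+t<k) (cong suc (sym (toℕ-fromℕ< t<k)))

colour : ℕ → ℕ → Parity
colour m x with x ℕ<? m
... | yes _ = parity x
... | no  _ = parity x ⁻¹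

colour-rim : ∀ {m a} → a < m → colour m a ≡ parity a
colour-rim {m} {a} a<m with a ℕ<? m
... | yes _   = refl
... | no  a≮m = contradiction a<m a≮m

colour-hub : ∀ {m x} → m ≤ x → colour m x ≡ parity x ⁻¹
colour-hub {m} {x} m≤x with x ℕ<? m
... | yes x<m = contradiction (<-≤-trans x<m m≤x) (n≮n x)
... | no  _   = refl

-- For m = 0 the edge wrap is a loop, so 0 < m cannot be dropped.
colour-edge : ∀ {m a b} → parity m ≡ 0ℙ → 0 < m → Edge m a b → colour m b ≡ colour m a ⁻¹
colour-edge {m} m-even 0<m (rim {a} 1+a<m) = begin
  colour m (suc a)         ≡⟨ colour-rim 1+a<m ⟩
  parity (suc a)           ≡⟨ parity-suc a ⟩
  parity a ⁻¹              ≡⟨ cong _⁻¹ (colour-rim (<-trans (n<1+n a) 1+a<m)) ⟨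
  colour m a ⁻¹            ∎
  where open ≡-Reasoning
colour-edge {suc m′} m-even 0<m wrap = begin
  colour (suc m′) m′       ≡⟨ colour-rim (n<1+n m′) ⟩
  parity m′                ≡⟨ parity[1+n]≡0ℙ⇒parity[n]≡1ℙ m′ m-even ⟩
  1ℙ                       ≡⟨ cong _⁻¹ (colour-rim 0<m) ⟨
  colour (suc m′) 0 ⁻¹     ∎
  where open ≡-Reasoning
colour-edge {m} m-even 0<m hub = begin
  colour m (suc m)         ≡⟨ colour-hub (n≤1+n m) ⟩
  parity (suc m) ⁻¹        ≡⟨ cong _⁻¹ (parity-suc m) ⟩
  parity m ⁻¹ ⁻¹           ≡⟨ cong _⁻¹ (colour-hub {m} ≤-refl) ⟨
  colour m m ⁻¹            ∎
  where open ≡-Reasoning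
colour-edge {m} m-even 0<m (spokeU {a} a<m 2∣a) = begin
  colour m a               ≡⟨ colour-rim a<m ⟩
  parity a                 ≡⟨ 2∣⇒parity≡0ℙ 2∣a ⟩
  0ℙ                       ≡⟨ cong (λ p → p ⁻¹ ⁻¹) m-even ⟨
  parity m ⁻¹ ⁻¹           ≡⟨ cong _⁻¹ (colour-hub {m} ≤-refl) ⟨
  colour m m ⁻¹            ∎
  where open ≡-Reasoning
colour-edge {m} m-even 0<m (spokeW {a} a<m 2∤a) = begin
  colour m a               ≡⟨ colour-rim a<m ⟩
  parity a                 ≡⟨ ¬2∣⇒parity≡1ℙ 2∤a ⟩
  1ℙ                       ≡⟨ cong (λ p → p ⁻¹ ⁻¹ ⁻¹) m-even ⟨
  parity m ⁻¹ ⁻¹ ⁻¹        ≡⟨ cong (λ p → p ⁻¹ ⁻¹) (parity-suc m) ⟨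
  parity (suc m) ⁻¹ ⁻¹     ≡⟨ cong _⁻¹ (colour-hub (n≤1+n m)) ⟨
  colour m (suc m) ⁻¹      ∎
  where open ≡-Reasoning

colour-adj : ∀ {m} → parity m ≡ 0ℙ → 0 < m →
             ∀ {x y} → Adj (2 + m) x y → colour m (toℕ y) ≡ colour m (toℕ x) ⁻¹
colour-adj m-even 0<m (inj₁ e) = colour-edge m-even 0<m e
colour-adj m-even 0<m (inj₂ e) = sym (⁻¹-selfInverse (sym (colour-edge m-even 0<m e)))

hasCycle⇒parity≡0ℙ : ∀ {m k} → parity m ≡ 0ℙ → 0 < m → HasCycle (2 + m) k → parity k ≡ 0ℙ
hasCycle⇒parity≡0ℙ {m} m-even 0<m (f , _ , adj) =
  cyclicallyAlternating⇒parity≡0ℙ (colour m ∘ toℕ ∘ f) (λ i j i→j → colour-adj m-even 0<m (adj i j i→j))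

module _ {m r : ℕ} (r<m : r < m) (r-odd : parity r ≡ 1ℙ) where

  rimHubIndex : Fin (3 + r) → ℕ
  rimHubIndex fzero               = suc m
  rimHubIndex (fsuc fzero)        = m
  rimHubIndex (fsuc (fsuc i))     = toℕ i

  rim<m : (i : Fin (suc r)) → toℕ i < m
  rim<m i = <-≤-trans (toℕ<n i) r<m

  rimHubIndex<2+m : ∀ i → rimHubIndex i < 2 + m
  rimHubIndex<2+m fzero           = n<1+n (suc m)
  rimHubIndex<2+m (fsuc fzero)    = <-trans (n<1+n m) (n<1+n (suc m))
  rimHubIndex<2+m (fsuc (fsuc i)) = <-trans (rim<m i) (<-trans (n<1+n m) (n<1+n (suc m)))

  rimHubIndex-injective : Injective _≡_ _≡_ rimHubIndex
  rimHubIndex-injective {fzero}         {fzero}         _ = refl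
  rimHubIndex-injective {fzero}         {fsuc fzero}    e = contradiction e 1+n≢n
  rimHubIndex-injective {fzero}         {fsuc (fsuc j)} e = contradiction (sym e) (<⇒≢ (m<n⇒m<1+n (rim<m j)))
  rimHubIndex-injective {fsuc fzero}    {fzero}         e = contradiction (sym e) 1+n≢n
  rimHubIndex-injective {fsuc fzero}    {fsuc fzero}    _ = refl
  rimHubIndex-injective {fsuc fzero}    {fsuc (fsuc j)} e = contradiction (sym e) (<⇒≢ (rim<m j))
  rimHubIndex-injective {fsuc (fsuc i)} {fzero}         e = contradiction e (<⇒≢ (m<n⇒m<1+n (rim<m i)))
  rimHubIndex-injective {fsuc (fsuc i)} {fsuc fzero}    e = contradiction e (<⇒≢ (rim<m i))
  rimHubIndex-injective {fsuc (fsuc i)} {fsuc (fsuc j)} e = cong (fsuc ∘ fsuc) (toℕ-injective e)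

  rimHubCycle : Fin (3 + r) → Fin (2 + m)
  rimHubCycle i = fromℕ< (rimHubIndex<2+m i)

  toℕ-rimHubCycle : ∀ i → toℕ (rimHubCycle i) ≡ rimHubIndex i
  toℕ-rimHubCycle i = toℕ-fromℕ< (rimHubIndex<2+m i)

  edge⇒adj : ∀ i j → Edge m (rimHubIndex i) (rimHubIndex j) → Adj (2 + m) (rimHubCycle i) (rimHubCycle j)
  edge⇒adj i j = inj₁ ∘ subst₂ (Edge m) (sym (toℕ-rimHubCycle i)) (sym (toℕ-rimHubCycle j))

  rimHubCycle-adj : ∀ i j → CycSucc (3 + r) i j → Adj (2 + m) (rimHubCycle i) (rimHubCycle j)
  rimHubCycle-adj fzero (fsuc fzero) (inj₁ refl) = swap (edge⇒adj (fsuc fzero) fzero hub)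
  rimHubCycle-adj (fsuc fzero) (fsuc (fsuc fzero)) (inj₁ refl) =
    edge⇒adj (fsuc fzero) (fsuc (fsuc fzero)) (spokeU (rim<m fzero) (2 ∣0))
  rimHubCycle-adj (fsuc (fsuc i)) (fsuc (fsuc j)) (inj₁ j≡1+i) =
    edge⇒adj (fsuc (fsuc i)) (fsuc (fsuc j)) (subst (Edge m (toℕ i)) (sym j≡1+i′) (rim 1+i<m))
    where
    j≡1+i′ : toℕ j ≡ suc (toℕ i)
    j≡1+i′ = suc-injective (suc-injective j≡1+i)
    1+i<m : suc (toℕ i) < m
    1+i<m = subst (_< m) j≡1+i′ (rim<m j)
  rimHubCycle-adj (fsuc (fsuc i)) fzero (inj₂ (i-last , refl)) =
    swap (edge⇒adj fzero (fsuc (fsuc i)) (spokeW (rim<m i) (parity≡1ℙ⇒¬2∣ i-odd)))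
    where
    i-odd : parity (toℕ i) ≡ 1ℙ
    i-odd = trans (cong parity (suc-injective (suc-injective (suc-injective i-last)))) r-odd
  rimHubCycle-adj fzero           fzero                  (inj₁ ())
  rimHubCycle-adj fzero           (fsuc (fsuc _))        (inj₁ ())
  rimHubCycle-adj (fsuc fzero)    fzero                  (inj₁ ())
  rimHubCycle-adj (fsuc fzero)    (fsuc fzero)           (inj₁ ())
  rimHubCycle-adj (fsuc fzero)    (fsuc (fsuc (fsuc _))) (inj₁ ())
  rimHubCycle-adj (fsuc (fsuc _)) fzero                  (inj₁ ())
  rimHubCycle-adj (fsuc (fsuc _)) (fsuc fzero)           (inj₁ ())
  rimHubCycle-adj _               (fsuc _)               (inj₂ (_ , ()))
  rimHubCycle-adj fzero           fzero                  (inj₂ (() , _))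
  rimHubCycle-adj (fsuc fzero)    fzero                  (inj₂ (() , _))

  rimHubCycle-injective : Injective _≡_ _≡_ rimHubCycle
  rimHubCycle-injective {i} {j} e = rimHubIndex-injective (begin
    rimHubIndex i         ≡⟨ toℕ-rimHubCycle i ⟨
    toℕ (rimHubCycle i)   ≡⟨ cong toℕ e ⟩
    toℕ (rimHubCycle j)   ≡⟨ toℕ-rimHubCycle j ⟩
    rimHubIndex j         ∎)
    where open ≡-Reasoning

  hasCycle-rimHub : HasCycle (2 + m) (3 + r)
  hasCycle-rimHub = rimHubCycle , rimHubCycle-injective , rimHubCycle-adj

lemma7 : (n : ℕ) → 6 ≤ n → 2 ∣ n →
    (k : ℕ) → 3 ≤ k → k ≤ n → (HasCycle n k ⇔ 2 ∣ k)
lemma7 (suc (suc m)) (s≤s (s≤s 4≤m)) 2∣n (suc (suc (suc r))) (s≤s (s≤s (s≤s _))) k≤n =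
  mk⇔ (parity≡0ℙ⇒2∣ (3 + r) ∘ hasCycle⇒parity≡0ℙ m-even 0<m)
      (λ 2∣k → hasCycle-rimHub (s≤s⁻¹ (s≤s⁻¹ k≤n)) (parity[1+n]≡0ℙ⇒parity[n]≡1ℙ r (2∣⇒parity≡0ℙ 2∣k)))
  where
  m-even : parity m ≡ 0ℙ
  m-even = 2∣⇒parity≡0ℙ 2∣n
  0<m : 0 < m
  0<m = <-≤-trans (s≤s z≤n) 4≤m
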